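{- Let $\theta$ be a path, $F$ a functional and $(i,G)$ be critical for $F$ at $\theta$. Then $(i,\pi_k(G))$ is critical for $\pi_k(F)$ at $\pi_k(\theta)$.
   Context: Fix $n>0$ and $S\subseteq\{1,\dots,n\}$. Functionals are sequential functionals of type $(\iota\rightarrow\iota)^n\rightarrow\iota$ (those $[\![ P ]\!]$ denoted by sequential procedures $P$), with $\iota=\mathbb N_\bot$ and $\iota\rightarrow\iota$ the monotone functions $\mathbb N_\bot\rightarrow\mathbb N_\bot$. $\pi_k$ is the projection of the standard sequential embedding-projection pair onto the functionals over the base interpretation $\{\bot,0,\dots,k\}$ (induced by restriction at base type), used at all relevant types. For $T\subseteq\{1,\ldots,n\}$, $F_T(\vec f)=a$ iff some $\vec g\sqsubseteq\vec f$ with $g_i(\bot)=\bot$ for $i\in T$ has $F(\vec g)=a$; $F$ is a $T$-functional if $F_T=F$. An $S$-query is $(i,G)$ with $G$ a constant in $\mathbb N$ if $i\in S$ and $G$ an $S\cup\{i\}$-functional if $i\notin S$. A path ($S$-path) is a finite sequence $\theta=(i_1,G_1,b_1),\dots,(i_m,G_m,b_m)$ of $S$-queries with values $b_j\in\mathbb N$ matching some $\vec f$, where $\vec f$ matches $\theta$ if $f_{i_j}(G_j(\vec f))=b_j$ for all $j$; $\pi_k(\theta)=(i_1,\pi_k(G_1),b_1),\dots,(i_m,\pi_k(G_m),b_m)$. An $S$-query $(i,G)$ is critical for $F$ at $\theta$ if for every $\vec f$ matching $\theta$ with $F(\vec f)\in\mathbb N$ we have $f_i(G(\vec f))\in\mathbb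 N$. -}

module Defs where

open import Data.Nat using (ℕ; suc; _<?_)
open import Data.Fin using (Fin; toℕ; fromℕ<)
open import Data.Fin.Subset using (Subset; _∈_; _∉_; _∪_; ⁅_⁆)
open import Data.Maybe using (Maybe; just; nothing; _>>=_)
import Data.Maybe as Maybe
open import Data.Product using (Σ; ∃; _×_; _,_; proj₁; proj₂)
open import Data.Sum using (_⊎_; inj₁; inj₂)
open import Data.List using (List; map; []; _∷_)
open import Data.List.Relation.Unary.All using (All)
open import Relation.Binary.PropositionalEquality
open import Relation.Nullary using (yes; no)
open import Function.Bundles using (_⇔_)
open import Function using (id)

-- Flat domains B_⊥ are represented as Maybe B (nothing = ⊥).
-- Monotone maps B_⊥ → B_⊥ (type ι → ι over base B).

record Mono (B : Set) : Set where
  field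
    ap   : Maybe B → Maybe B
    mono : ∀ {b} → ap nothing ≡ just b → ∀ x → ap x ≡ just b
open Mono public

Args : Set → ℕ → Set
Args B n = Fin n → Mono B

_⊑_ : ∀ {B n} → Args B n → Args B n → Set
g ⊑ f = ∀ i x b → ap (g i) x ≡ just b → ap (f i) x ≡ just b

-- a (partial) functional (ι→ι)^n → ι over base B, given by its graph:
-- F f a  means  F(f) = a
Sem : Set → ℕ → Set₁
Sem B n = Args B n → B → Set

-- A procedure is a (possibly infinite, infinitely branching) tree,
-- given as a labelling of positions.  A position is a list of steps:
-- 'arg' enters the argument Q of a node  case f_i(Q) of (b ⇒ R b),
-- 'br b' enters the branch R b.

data Node (n : ℕ) : Set where
  ⊥ₚ   : Node n
  ret  : ℕ → Node n
  case : Fin n → Node n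

data Step : Set where
  arg : Step
  br  : ℕ → Step

Proc : ℕ → Set
Proc n = List Step → Node n

sub : ∀ {n} → Proc n → Step → Proc n
sub P s p = P (s ∷ p)

-- Evaluation (least-fixed-point semantics): Eval f P a  iff  ⟦P⟧(f) = a
data Eval {n : ℕ} (f : Args ℕ n) : Proc n → ℕ → Set where
  ev-ret   : ∀ {P a} → P [] ≡ ret a → Eval f P a
  ev-caseᶜ : ∀ {P i b a} → P [] ≡ case i →
             ap (f i) nothing ≡ just b → Eval f (sub P (br b)) a → Eval f P a
  ev-caseˢ : ∀ {P i d b a} → P [] ≡ case i →
             Eval f (sub P arg) d → ap (f i) (just d) ≡ just b →
             Eval f (sub P (br b)) a → Eval f P a

⟦_⟧ : ∀ {n} → Proc n → Sem ℕ n
⟦ P ⟧ f a = Eval f P a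

restrictT : ∀ {n} → Subset n → Sem ℕ n → Sem ℕ n
restrictT T F f a =
  ∃ λ g → g ⊑ f × (∀ i → i ∈ T → ap (g i) nothing ≡ nothing) × F g a

IsTFunctional : ∀ {n} → Subset n → Sem ℕ n → Set
IsTFunctional T F = ∀ f a → restrictT T F f a ⇔ F f a

IsConstant : ∀ {n} → Sem ℕ n → Set
IsConstant F = ∃ λ c → ∀ f a → F f a ⇔ (a ≡ c)

record SQuery {n : ℕ} (S : Subset n) : Set where
  field
    idx     : Fin n
    fun     : Proc n
    okIn    : idx ∈ S → IsConstant ⟦ fun ⟧
    okNotIn : idx ∉ S → IsTFunctional (S ∪ ⁅ idx ⁆) ⟦ fun ⟧
open SQuery public

-- Paths, matching and criticality, generic in the base B
-- (toN : B → ℕ interprets the base values; path values b_j are in ℕ)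

Entry : Set → ℕ → Set₁
Entry B n = Fin n × Sem B n × ℕ

-- f_i(G(f)) = c
AppIs : ∀ {B n} → Args B n → Fin n → Sem B n → B → Set
AppIs f i G c =
  ap (f i) nothing ≡ just c ⊎ ∃ λ d → G f d × ap (f i) (just d) ≡ just c

MatchesEntry : ∀ {B n} → (B → ℕ) → Args B n → Entry B n → Set
MatchesEntry toN f (i , G , b) = ∃ λ c → AppIs f i G c × toN c ≡ b

Matches : ∀ {B n} → (B → ℕ) → Args B n → List (Entry B n) → Set₁
Matches toN f θ = All (MatchesEntry toN f) θ

Critical : ∀ {B n} → (B → ℕ) → Sem B n → List (Entry B n) →
           Fin n → Sem B n → Set₁
Critical toN F θ i G =
  ∀ f → Matches toN f θ → (∃ λ a → F f a) → ∃ λ c → AppIs f i G c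

entry : ∀ {n} {S : Subset n} → SQuery S × ℕ → Entry ℕ n
entry (q , b) = idx q , ⟦ fun q ⟧ , b

entries : ∀ {n} {S : Subset n} → List (SQuery S × ℕ) → List (Entry ℕ n)
entries θ = map entry θ

IsPath : ∀ {n} {S : Subset n} → List (SQuery S × ℕ) → Set₁
IsPath θ = ∃ λ f → Matches id f (entries θ)

-- The model over base {⊥,0,…,k}, represented by Fin (suc k),
-- and the standard embedding–projection pair.

Bk : ℕ → Set
Bk k = Fin (suc k)

pι : (k : ℕ) → ℕ → Maybe (Bk k)
pι k a with a <? suc k
... | yes a<k = just (fromℕ< a<k)
... | no  _   = nothing

-- embedding at type ι → ι :  e(f) = e ∘ f ∘ p
private
  embAp : ∀ {k} → Mono (Bk k) → Maybe ℕ → Maybe ℕ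
  embAp {k} f x = Maybe.map toℕ (ap f (x >>= pι k))

  embMono : ∀ {k} (f : Mono (Bk k)) {b} → embAp f nothing ≡ just b →
            ∀ x → embAp f x ≡ just b
  embMono {k} f {b} eq x with ap f nothing in e₀
  ... | just c with mono f e₀ (x >>= pι k)
  ...   | e₁ rewrite e₁ = eq

emb : ∀ {k} → Mono (Bk k) → Mono ℕ
emb f = record { ap = embAp f ; mono = embMono f }

embArgs : ∀ {k n} → Args (Bk k) n → Args ℕ n
embArgs f i = emb (f i)

-- π_k on functionals: π_k(F)(f) = p(F(e f))
πF : ∀ {n} (k : ℕ) → Sem ℕ n → Sem (Bk k) n
πF k F f c = F (embArgs f) (toℕ c)

πEntry : ∀ {n} (k : ℕ) → Entry ℕ n → Entry (Bk k) n
πEntry k (i , G , b) = i , πF k G , b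

πPath : ∀ {n} (k : ℕ) → List (Entry ℕ n) → List (Entry (Bk k) n)
πPath k θ = map (πEntry k) θ

-- The projection π_k is p ∘ F ∘ e, so a k-bounded argument tuple f sees
-- everything through its embedding e f.  If e f matches θ and F(e f) is
-- defined, criticality at θ makes (e f)_i(G(e f)) defined; since e ∘ f ∘ p
-- is defined only where f ∘ p is, f_i(π_k(G)(f)) is defined as well.
module Submission where

open import Defs
open import Data.Nat using (ℕ; _<_; suc; _<?_)
open import Data.Fin using (toℕ)
open import Data.Fin.Properties using (toℕ<n; fromℕ<-toℕ; toℕ-fromℕ<)
open import Data.Fin.Subset using (Subset)
open import Data.Product using (∃; _×_; _,_)
open import Data.Sum using (inj₁; inj₂)
open import Data.List using (List)
import Data.List.Relation.Unary.All as All
open import Data.List.Relation.Unary.All.Properties using (map⁻)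
open import Data.Maybe using (just; nothing; _>>=_)
import Data.Maybe as Maybe
open import Relation.Binary.PropositionalEquality
open import Relation.Nullary using (yes; no)
open import Data.Empty using (⊥-elim)
open import Function using (id; _∘_)

pι-toℕ : ∀ k (d : Bk k) → pι k (toℕ d) ≡ just d
pι-toℕ k d with toℕ d <? suc k
... | yes p = cong just (fromℕ<-toℕ d p)
... | no ¬p = ⊥-elim (¬p (toℕ<n d))

pι≡just⇒toℕ≡ : ∀ k d {d′ : Bk k} → pι k d ≡ just d′ → toℕ d′ ≡ d
pι≡just⇒toℕ≡ k d eq with d <? suc k
pι≡just⇒toℕ≡ k d refl | yes p = toℕ-fromℕ< p

module _ {k : ℕ} (g : Mono (Bk k)) where

  emb-ap-toℕ : ∀ d → ap (emb g) (just (toℕ d)) ≡ Maybe.map toℕ (ap g (just d))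
  emb-ap-toℕ d = cong (Maybe.map toℕ ∘ ap g) (pι-toℕ k d)

  emb-defined⇒defined : ∀ x {c} → ap (emb g) x ≡ just c →
                        ∃ λ c′ → ap g (x >>= pι k) ≡ just c′
  emb-defined⇒defined x eq with ap g (x >>= pι k)
  ... | just c′ = c′ , refl

module _ {n k : ℕ} (f : Args (Bk k) n) where

  appIs-π⇒appIs-emb : ∀ i (G : Sem ℕ n) {c} → AppIs f i (πF k G) c →
                      AppIs (embArgs f) i G (toℕ c)
  appIs-π⇒appIs-emb i G (inj₁ eq) = inj₁ (cong (Maybe.map toℕ) eq)
  appIs-π⇒appIs-emb i G (inj₂ (d , Gd , eq)) =
    inj₂ (toℕ d , Gd , trans (emb-ap-toℕ (f i) d) (cong (Maybe.map toℕ) eq))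

  matchesEntry-π⇒matchesEntry-emb : (e : Entry ℕ n) →
    MatchesEntry toℕ f (πEntry k e) → MatchesEntry id (embArgs f) e
  matchesEntry-π⇒matchesEntry-emb (i , G , b) (c , app , c≡b) =
    toℕ c , appIs-π⇒appIs-emb i G app , c≡b

  matches-π⇒matches-emb : (θ : List (Entry ℕ n)) →
    Matches toℕ f (πPath k θ) → Matches id (embArgs f) θ
  matches-π⇒matches-emb θ m =
    All.map (λ {e} → matchesEntry-π⇒matchesEntry-emb e) (map⁻ m)

  defined-emb⇒defined-π : ∀ i (G : Sem ℕ n) {c} → AppIs (embArgs f) i G c →
                          ∃ λ c′ → AppIs f i (πF k G) c′
  defined-emb⇒defined-π i G (inj₁ eq) with emb-defined⇒defined (f i) nothing eq
  ... | c′ , e = c′ , inj₁ e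
  defined-emb⇒defined-π i G (inj₂ (d , Gd , eq))
    with pι k d in ep | emb-defined⇒defined (f i) (just d) eq
  ... | nothing | c′ , e = c′ , inj₁ e
  ... | just d′ | c′ , e =
    c′ , inj₂ (d′ , subst (G (embArgs f)) (sym (pι≡just⇒toℕ≡ k d ep)) Gd , e)

critical-π : ∀ {n} k (F : Sem ℕ n) (θ : List (Entry ℕ n)) i (G : Sem ℕ n) →
             Critical id F θ i G →
             Critical toℕ (πF k F) (πPath k θ) i (πF k G)
critical-π k F θ i G crit f m (a , Fa)
  with crit (embArgs f) (matches-π⇒matches-emb f θ m) (toℕ a , Fa)
... | c , app = defined-emb⇒defined-π f i G app

lemma3p13 : ∀ {n : ℕ} → 0 < n → (S : Subset n) (k : ℕ)
    (F : Proc n) (θ : List (SQuery S × ℕ)) → IsPath θ →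
    (q : SQuery S) →
    Critical id ⟦ F ⟧ (entries θ) (idx q) ⟦ fun q ⟧ →
    Critical toℕ (πF k ⟦ F ⟧) (πPath k (entries θ)) (idx q) (πF k ⟦ fun q ⟧)
lemma3p13 _ S k F θ _ q = critical-π k ⟦ F ⟧ (entries θ) (idx q) ⟦ fun q ⟧
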